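{- Let $r\ge0$ and $n\ge1$ be integers. Then \[ D_{ -r,-r}(n)=\begin{cases}D_{0,0}(n-r),&\text{if } r<n,\\ 1,&\text{if } r\ge n.\end{cases} \]
   Context: $\mu$ is an indeterminate and all quantities lie in $\mathbb{Q}(\mu)$. For integers $s,t$ and $n\ge1$, $D_{s,t}(n)$ denotes the $n\times n$ determinant $\det\bigl(\delta_{i,j}+\binom{\mu+i+j-2}{j}\bigr)$ with row index $i$ running over $s\le i<s+n$ and column index $j$ over $t\le j<t+n$; here $\delta_{i,j}$ is the Kronecker delta and $\binom{x}{j}=x(x-1)\cdots(x-j+1)/j!$ for integers $j\ge0$, $\binom{x}{j}=0$ for integers $j<0$. -}

module Defs where

open import Data.Nat as ℕ using (ℕ; zero; suc)
open import Data.Integer as ℤ using (ℤ; +_; -[1+_])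
open import Data.Rational using (ℚ; _+_; _*_; _-_; -_; _/_; 0ℚ; 1ℚ)
open import Data.Fin using (Fin; zero; suc; toℕ; punchIn)
open import Relation.Nullary using (yes; no)

-- Falling-factorial binomial  binomℕ x k = x(x-1)...(x-k+1)/k!  for k : ℕ
binomℕ : ℚ → ℕ → ℚ
binomℕ x zero = 1ℚ
binomℕ x (suc k) = binomℕ x k * (x - (+ k / 1)) * (+ 1 / suc k)

binom : ℚ → ℤ → ℚ
binom x (+ k) = binomℕ x k
binom x -[1+ k ] = 0ℚ

δ : ℤ → ℤ → ℚ
δ i j with i ℤ.≟ j
... | yes _ = 1ℚ
... | no _ = 0ℚ

toℚ : ℤ → ℚ
toℚ z = z / 1

sign : ℕ → ℚ
sign zero = 1ℚ
sign (suc k) = - sign k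

sumFin : ∀ n → (Fin n → ℚ) → ℚ
sumFin zero f = 0ℚ
sumFin (suc n) f = f zero + sumFin n (λ j → f (suc j))

det : ∀ n → (Fin n → Fin n → ℚ) → ℚ
det zero M = 1ℚ
det (suc n) M =
  sumFin (suc n) (λ j → sign (toℕ j) * M zero j * det n (λ a b → M (suc a) (punchIn j b)))

entry : ℚ → ℤ → ℤ → ℚ
entry μ i j = δ i j + binom (μ + toℚ (i ℤ.+ j ℤ.- + 2)) j

D : ℚ → ℤ → ℤ → ℕ → ℚ
D μ s t n = det n (λ a b → entry μ (s ℤ.+ + toℕ a) (t ℤ.+ + toℕ b))

module Submission where

-- For r ≥ 1 the matrix of D_{-r,-r}(m+1) has first column
-- indexed by j = -r < 0, where binom(x, j) = 0, so that column is the
-- Kronecker column (δ_{i,-r})_i = (1,0,…,0)ᵀ.  Expanding along the first row,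
-- every cofactor except the (0,0) one contains this zero column and vanishes,
-- so the determinant equals its (0,0)-minor, which is D_{-r+1,-r+1}(m).
-- Hence D_{-r,-r}(n) = D_{-(r-1),-(r-1)}(n-1), and iterating r times gives
-- D_{0,0}(n-r) when r < n, or, after n steps, the empty determinant 1 when
-- n ≤ r.

open import Defs
open import Data.Nat using (ℕ; _<_; _≤_)
open import Data.Nat as ℕ using (_∸_; zero; suc; s≤s)
open import Data.Integer using (+_; -_)
open import Data.Rational using (ℚ; 1ℚ)
open import Data.Product using (_×_; _,_)
open import Relation.Binary.PropositionalEquality
  using (_≡_; refl; sym; trans; cong; cong₂; module ≡-Reasoning)

open import Algebra.Bundles using (AbelianGroup)
open import Data.Integer as ℤ using (ℤ; -[1+_])
import Data.Integer.Properties as ℤP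
open import Algebra.Properties.Group (AbelianGroup.group ℤP.+-0-abelianGroup)
  using (∙-cancelˡ)
import Data.Rational as Q
import Data.Rational.Properties as QP
open import Data.Fin using (Fin; zero; suc; toℕ; punchIn)
open import Relation.Nullary using (yes; no; ¬_)
open import Data.Empty using (⊥-elim)

Matrix : ℕ → Set
Matrix n = Fin n → Fin n → ℚ

minor : ∀ {n} → Fin (suc n) → Matrix (suc n) → Matrix n
minor j M a b = M (suc a) (punchIn j b)

cofactorTerm : ∀ {n} → Matrix (suc n) → Fin (suc n) → ℚ
cofactorTerm {n} M j = sign (toℕ j) Q.* M zero j Q.* det n (minor j M)

sumFin-cong : ∀ n {f g : Fin n → ℚ} → (∀ j → f j ≡ g j) → sumFin n f ≡ sumFin n g
sumFin-cong zero    e = refl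
sumFin-cong (suc n) e = cong₂ Q._+_ (e zero) (sumFin-cong n (λ j → e (suc j)))

sumFin-zero : ∀ n {f : Fin n → ℚ} → (∀ j → f j ≡ Q.0ℚ) → sumFin n f ≡ Q.0ℚ
sumFin-zero zero    e = refl
sumFin-zero (suc n) e = cong₂ Q._+_ (e zero) (sumFin-zero n (λ j → e (suc j)))

det-cong : ∀ n {M N : Matrix n} → (∀ a b → M a b ≡ N a b) → det n M ≡ det n N
det-cong zero    e = refl
det-cong (suc n) e = sumFin-cong (suc n) λ j →
  cong₂ Q._*_ (cong (sign (toℕ j) Q.*_) (e zero j))
              (det-cong n (λ a b → e (suc a) (punchIn j b)))

cofactorTerm-zero : ∀ {n} (M : Matrix (suc n)) j →
  det n (minor j M) ≡ Q.0ℚ → cofactorTerm M j ≡ Q.0ℚ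
cofactorTerm-zero M j e =
  trans (cong (sign (toℕ j) Q.* M zero j Q.*_) e) (QP.*-zeroʳ (sign (toℕ j) Q.* M zero j))

-- A matrix whose first column is zero has determinant zero: the 0-th
-- cofactor term has the factor M 0 0 = 0, the others have a minor whose
-- first column is again zero.
det-zeroFirstColumn : ∀ n (M : Matrix (suc n)) →
  (∀ a → M a zero ≡ Q.0ℚ) → det (suc n) M ≡ Q.0ℚ
det-zeroFirstColumn n M e = sumFin-zero (suc n) (term n M e)
  where
  open ≡-Reasoning
  term : ∀ n (M : Matrix (suc n)) → (∀ a → M a zero ≡ Q.0ℚ) →
    ∀ j → cofactorTerm M j ≡ Q.0ℚ
  term n M e zero = begin
    sign 0 Q.* M zero zero Q.* det n (minor zero M)
      ≡⟨ cong (λ x → sign 0 Q.* x Q.* det n (minor zero M)) (e zero) ⟩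
    sign 0 Q.* Q.0ℚ Q.* det n (minor zero M)
      ≡⟨ cong (Q._* det n (minor zero M)) (QP.*-zeroʳ (sign 0)) ⟩
    Q.0ℚ Q.* det n (minor zero M)
      ≡⟨ QP.*-zeroˡ (det n (minor zero M)) ⟩
    Q.0ℚ ∎
  term (suc n) M e (suc j) =
    cofactorTerm-zero M (suc j)
      (det-zeroFirstColumn n (minor (suc j) M) (λ a → e (suc a)))

-- If the first column of M is (1,0,…,0)ᵀ then det M is the (0,0)-minor:
-- every other cofactor term has a minor with zero first column.
det-unitFirstColumn : ∀ n (M : Matrix (suc n)) →
  M zero zero ≡ 1ℚ → (∀ a → M (suc a) zero ≡ Q.0ℚ) →
  det (suc n) M ≡ det n (λ a b → M (suc a) (suc b))
det-unitFirstColumn n M one zeros = begin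
    det (suc n) M
  ≡⟨ cong₂ Q._+_ (cong (λ x → sign 0 Q.* x Q.* X) one)
                 (sumFin-zero n (λ j → cofactorTerm-zero M (suc j) (minorVanishes n j M zeros))) ⟩
    1ℚ Q.* 1ℚ Q.* X Q.+ Q.0ℚ
  ≡⟨ QP.+-identityʳ _ ⟩
    1ℚ Q.* 1ℚ Q.* X
  ≡⟨ QP.*-identityˡ X ⟩
    X ∎
  where
  open ≡-Reasoning
  X : ℚ
  X = det n (λ a b → M (suc a) (suc b))
  minorVanishes : ∀ n (j : Fin n) (M : Matrix (suc n)) →
    (∀ a → M (suc a) zero ≡ Q.0ℚ) → det n (minor (suc j) M) ≡ Q.0ℚ
  minorVanishes (suc m) j M zeros = det-zeroFirstColumn m (minor (suc j) M) zeros

δ-refl : ∀ i → δ i i ≡ 1ℚ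
δ-refl i with i ℤ.≟ i
... | yes _ = refl
... | no i≢i = ⊥-elim (i≢i refl)

δ-≢ : ∀ i j → ¬ (i ≡ j) → δ i j ≡ Q.0ℚ
δ-≢ i j i≢j with i ℤ.≟ j
... | yes i≡j = ⊥-elim (i≢j i≡j)
... | no _ = refl

entry-negativeColumn : ∀ μ i r → entry μ i -[1+ r ] ≡ δ i -[1+ r ]
entry-negativeColumn μ i r = QP.+-identityʳ (δ i -[1+ r ])

shiftIndex : ∀ s k → s ℤ.+ + suc k ≡ (s ℤ.+ + 1) ℤ.+ + k
shiftIndex s k = sym (ℤP.+-assoc s (+ 1) (+ k))

D-minor : ∀ μ s t m →
  det m (λ a b → entry μ (s ℤ.+ + suc (toℕ a)) (t ℤ.+ + suc (toℕ b)))
    ≡ D μ (s ℤ.+ + 1) (t ℤ.+ + 1) m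
D-minor μ s t m = det-cong m λ a b →
  cong₂ (entry μ) (shiftIndex s (toℕ a)) (shiftIndex t (toℕ b))

-- Peeling: for s = -(r+1) < 0 the first column of D_{s,s}(m+1) is a unit
-- column, so D_{-(r+1),-(r+1)}(m+1) = D_{-r,-r}(m).
D-peel : ∀ μ r m → D μ (- (+ suc r)) (- (+ suc r)) (suc m) ≡ D μ (- (+ r)) (- (+ r)) m
D-peel μ r m = begin
    D μ s s (suc m)
  ≡⟨ det-unitFirstColumn m (λ a b → entry μ (s ℤ.+ + toℕ a) (s ℤ.+ + toℕ b)) diagonal offDiagonal ⟩
    det m (λ a b → entry μ (s ℤ.+ + suc (toℕ a)) (s ℤ.+ + suc (toℕ b)))
  ≡⟨ D-minor μ s s m ⟩
    D μ (s ℤ.+ + 1) (s ℤ.+ + 1) m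
  ≡⟨ cong (λ t → D μ t t m) (predecessorStep r) ⟩
    D μ (- (+ r)) (- (+ r)) m ∎
  where
  open ≡-Reasoning
  s : ℤ
  s = -[1+ r ]
  column₀ : s ℤ.+ + 0 ≡ s
  column₀ = ℤP.+-identityʳ s
  diagonal : entry μ (s ℤ.+ + 0) (s ℤ.+ + 0) ≡ 1ℚ
  diagonal rewrite column₀ = trans (entry-negativeColumn μ s r) (δ-refl s)
  offDiagonal : ∀ a → entry μ (s ℤ.+ + suc (toℕ a)) (s ℤ.+ + 0) ≡ Q.0ℚ
  offDiagonal a rewrite column₀ =
    trans (entry-negativeColumn μ row r)
          (δ-≢ row s λ eq → sucDistinct (∙-cancelˡ s (+ suc (toℕ a)) (+ 0) (trans eq (sym column₀))))
    where
    row : ℤ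
    row = s ℤ.+ + suc (toℕ a)
    sucDistinct : ¬ (+ suc (toℕ a) ≡ + 0)
    sucDistinct ()
  predecessorStep : ∀ r → -[1+ r ] ℤ.+ + 1 ≡ - (+ r)
  predecessorStep zero    = refl
  predecessorStep (suc r) = refl

D-peel-below : ∀ μ r n → r < n → D μ (- (+ r)) (- (+ r)) n ≡ D μ (+ 0) (+ 0) (n ∸ r)
D-peel-below μ zero    n       _       = refl
D-peel-below μ (suc r) (suc m) (s≤s p) = trans (D-peel μ r m) (D-peel-below μ r m p)

D-peel-above : ∀ μ r n → n ≤ r → D μ (- (+ r)) (- (+ r)) n ≡ 1ℚ
D-peel-above μ r       zero    _       = refl
D-peel-above μ (suc r) (suc m) (s≤s p) = trans (D-peel μ r m) (D-peel-above μ r m p)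

corollary15 : (μ : ℚ) (r n : ℕ) → 1 ≤ n →
    (r < n → D μ (- (+ r)) (- (+ r)) n ≡ D μ (+ 0) (+ 0) (n ∸ r))
    × (n ≤ r → D μ (- (+ r)) (- (+ r)) n ≡ 1ℚ)
corollary15 μ r n _ = D-peel-below μ r n , D-peel-above μ r n
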